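{- The matroids $Q_6$, $P_6$, and $U_{3,6}$ are excluded minors for the class $\mathcal{Z}$.
   Context: $\mathcal{Z}$ is the class of matroids $M$ such that, for every $e\in E(M)$, at least one of $M\backslash e$ and $M/e$ is binary. An excluded minor for a minor-closed class is a matroid not in the class all of whose proper minors are in it. $P_6$ is the six-element rank-3 matroid whose only non-spanning circuit is a single 3-element circuit. $Q_6$ is the six-element rank-3 matroid whose non-spanning circuits are exactly two 3-element circuits sharing exactly one element. -}

module Defs where

open import Data.Nat using (ℕ; zero; suc; _<_; _≤ᵇ_)
open import Data.Bool using (Bool; true; false; if_then_else_; _xor_; _∧_; not; _∨_)
open import Data.Fin using (Fin; zero; suc)
open import Data.Fin.Subset using (Subset; ⊥; _⊆_; _∪_; ⁅_⁆; ∣_∣; _∈_; _∉_; Nonempty)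
open import Data.Vec using (Vec; []; _∷_; replicate; zipWith; insertAt)
open import Data.Product using (Σ; ∃; _×_; _,_)
open import Data.Sum using (_⊎_)
open import Relation.Binary.PropositionalEquality using (_≡_; _≢_)
open import Relation.Nullary using (¬_)

-- A (raw) set system on the ground set Fin n, given by its (decidable)
-- independence predicate: X is independent iff Ind X ≡ true.
Raw : ℕ → Set
Raw n = Subset n → Bool

record IsMatroid {n : ℕ} (M : Raw n) : Set where
  field
    empty-indep : M ⊥ ≡ true
    down-closed : ∀ X Y → X ⊆ Y → M Y ≡ true → M X ≡ true
    augment     : ∀ X Y → M X ≡ true → M Y ≡ true → ∣ X ∣ < ∣ Y ∣ →
                  ∃ λ e → e ∈ Y × e ∉ X × M (X ∪ ⁅ e ⁆) ≡ true

_∖_ : ∀ {n} → Raw (suc n) → Fin (suc n) → Raw n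
(M ∖ e) X = M (insertAt X e false)

-- Contraction M / e : if e is a loop, M / e = M \ e; otherwise
-- X is independent in M / e iff X ∪ e is independent in M.
_／_ : ∀ {n} → Raw (suc n) → Fin (suc n) → Raw n
(M ／ e) X = if M ⁅ e ⁆ then M (insertAt X e true) else M (insertAt X e false)

-- Linear algebra over GF(2): a matrix with m rows and columns indexed by Fin n.
Matrix₂ : ℕ → ℕ → Set
Matrix₂ m n = Fin n → Vec Bool m

colSum : ∀ {m n} → Matrix₂ m n → Subset n → Vec Bool m
colSum {m} {zero} A [] = replicate m false
colSum {m} {suc n} A (b ∷ Y) =
  zipWith _xor_ (if b then A zero else replicate m false) (colSum (λ i → A (suc i)) Y)

LinIndep₂ : ∀ {m n} → Matrix₂ m n → Subset n → Set
LinIndep₂ {m} A X = ∀ Y → Y ⊆ X → Nonempty Y → colSum A Y ≢ replicate m false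

Binary : ∀ {n} → Raw n → Set
Binary {n} M = Σ ℕ λ m → Σ (Matrix₂ m n) λ A →
  ∀ X → (M X ≡ true → LinIndep₂ A X) × (LinIndep₂ A X → M X ≡ true)

InZ : ∀ {n} → Raw n → Set
InZ {zero} M = Data.Unit.⊤ where import Data.Unit
InZ {suc n} M = ∀ e → Binary (M ∖ e) ⊎ Binary (M ／ e)

data _≼_ : ∀ {k n} → Raw k → Raw n → Set
data _≺_ : ∀ {k n} → Raw k → Raw n → Set

data _≼_ where
  self   : ∀ {n} {M : Raw n} → M ≼ M
  proper : ∀ {k n} {N : Raw k} {M : Raw n} → N ≺ M → N ≼ M

data _≺_ where
  via-del : ∀ {k n} {N : Raw k} {M : Raw (suc n)} (e : Fin (suc n)) → N ≼ (M ∖ e) → N ≺ M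
  via-con : ∀ {k n} {N : Raw k} {M : Raw (suc n)} (e : Fin (suc n)) → N ≼ (M ／ e) → N ≺ M

ExcludedMinorZ : ∀ {n} → Raw n → Set
ExcludedMinorZ M = IsMatroid M × ¬ InZ M × (∀ {k} (N : Raw k) → N ≺ M → InZ N)

U36 : Raw 6
U36 X = ∣ X ∣ ≤ᵇ 3

is012 : Subset 6 → Bool
is012 (true ∷ true ∷ true ∷ false ∷ false ∷ false ∷ []) = true
is012 _ = false

is234 : Subset 6 → Bool
is234 (false ∷ false ∷ true ∷ true ∷ true ∷ false ∷ []) = true
is234 _ = false

-- P_6: rank 3, only non-spanning circuit {0,1,2}.
P6 : Raw 6
P6 X = (∣ X ∣ ≤ᵇ 3) ∧ not (is012 X)

-- Q_6: rank 3, non-spanning circuits exactly {0,1,2} and {2,3,4}.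
Q6 : Raw 6
Q6 X = (∣ X ∣ ≤ᵇ 3) ∧ not (is012 X ∨ is234 X)

module Submission where

-- All three are concrete matroids on six elements, so each defining property
-- of an excluded minor is a finite statement; we prove it by evaluating a
-- boolean checker whose soundness is proved once and for all.
--   * The independence axioms are checked by enumerating pairs of subsets.
--   * M ∉ 𝒵 is witnessed at the element 0: each of M \ 0 and M / 0 has two
--     circuits whose symmetric difference is independent and nonempty.  In a
--     GF(2)-representation the columns of a circuit sum to zero, so the
--     columns of that symmetric difference would sum to zero too, hence no
--     such matroid is binary.
--   * Every proper minor lies in 𝒵.  The general facts behind this check are
--     that binary representations pass to deletions and contractions (delete
--     a column, resp. pivot on the contracted column), so minors of binary
--     matroids are binary, and binary matroids lie in 𝒵.  The checker
--     certifies a minor either as binary, via an explicit GF(2) matrix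
--     verified on all subsets, or as a member of 𝒵 all of whose
--     single-element deletions and contractions pass the check recursively.

open import Defs
open import Algebra.Bundles using (CommutativeMonoid)
import Algebra.Properties.CommutativeSemigroup as CommSemigroupProperties
open import Level using (0ℓ)
open import Data.Nat using (ℕ; zero; suc; _<_; _<ᵇ_)
open import Data.Nat.Properties using (<⇒<ᵇ)
open import Data.Bool using (Bool; true; false; if_then_else_; _xor_; _∧_; not; _∨_)
open import Data.Bool.Properties using (xor-comm; xor-assoc; xor-identityˡ; xor-identityʳ; xor-same; T-≡; ∧-commutativeMonoid; ∨-commutativeMonoid) renaming (_≟_ to _≟ᵇ_)
open import Data.Fin using (Fin; zero; suc; punchIn)
open import Data.Fin.Subset using (Subset; ⊥; _⊆_; _∪_; ⁅_⁆; ∣_∣; _∈_; _∉_; Nonempty)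
open import Data.Vec using (Vec; []; _∷_; replicate; zipWith; insertAt; removeAt; lookup; tabulate; _[_]≔_; allFin; foldl; _[_]=_; here; there)
open import Data.Vec.Properties using (insertAt-removeAt; lookup-replicate; lookup-zipWith; zipWith-comm; zipWith-assoc; zipWith-identityˡ; zipWith-identityʳ; ≡-dec; lookup⇒[]=; []=⇒lookup)
open import Data.Product using (Σ; ∃; _×_; _,_; proj₁; proj₂)
open import Data.Sum using (_⊎_; inj₁; inj₂)
open import Data.Empty using (⊥-elim)
open import Data.Unit using (tt)
open import Function.Bundles using (_⇔_; mk⇔; Equivalence)
open import Relation.Binary.PropositionalEquality using (_≡_; _≢_; refl; sym; trans; cong; cong₂; subst; isEquivalence; module ≡-Reasoning)
open import Relation.Nullary using (¬_; Dec; yes; no; does)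
open import Relation.Nullary.Decidable using (dec-true)

open Equivalence using (to; from)

∧-split : ∀ a b → a ∧ b ≡ true → a ≡ true × b ≡ true
∧-split true true _ = refl , refl

∧-intro : ∀ {a b} → a ≡ true → b ≡ true → a ∧ b ≡ true
∧-intro refl refl = refl

∨-split : ∀ a b → a ∨ b ≡ true → a ≡ true ⊎ b ≡ true
∨-split true b _ = inj₁ refl
∨-split false b p = inj₂ p

not-true : ∀ b → not b ≡ true → b ≢ true
not-true false _ ()

module ∧-Properties = CommSemigroupProperties (CommutativeMonoid.commutativeSemigroup ∧-commutativeMonoid)
module ∨-Properties = CommSemigroupProperties (CommutativeMonoid.commutativeSemigroup ∨-commutativeMonoid)

infixr 5 _⇒ᵇ_
_⇒ᵇ_ : Bool → Bool → Bool
true ⇒ᵇ c = c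
false ⇒ᵇ c = true

⇒ᵇ-mp : ∀ {a c} → a ⇒ᵇ c ≡ true → a ≡ true → c ≡ true
⇒ᵇ-mp h refl = h

does-true : ∀ {P : Set} (d : Dec P) → does d ≡ true → P
does-true (yes p) _ = p

𝟘 : ∀ m → Vec Bool m
𝟘 m = replicate m false

infixl 6 _⊕_
_⊕_ : ∀ {m} → Vec Bool m → Vec Bool m → Vec Bool m
_⊕_ = zipWith _xor_

infixr 7 _·_
_·_ : ∀ {m} → Bool → Vec Bool m → Vec Bool m
b · v = if b then v else 𝟘 _

⊕-identityˡ : ∀ {m} (v : Vec Bool m) → 𝟘 m ⊕ v ≡ v
⊕-identityˡ = zipWith-identityˡ xor-identityˡ

⊕-identityʳ : ∀ {m} (v : Vec Bool m) → v ⊕ 𝟘 m ≡ v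
⊕-identityʳ = zipWith-identityʳ xor-identityʳ

⊕-comm : ∀ {m} (u v : Vec Bool m) → u ⊕ v ≡ v ⊕ u
⊕-comm = zipWith-comm xor-comm

⊕-assoc : ∀ {m} (u v w : Vec Bool m) → (u ⊕ v) ⊕ w ≡ u ⊕ (v ⊕ w)
⊕-assoc = zipWith-assoc xor-assoc

⊕-self : ∀ {m} (v : Vec Bool m) → v ⊕ v ≡ 𝟘 m
⊕-self [] = refl
⊕-self (x ∷ v) = cong₂ _∷_ (xor-same x) (⊕-self v)

⊕-commutativeMonoid : ℕ → CommutativeMonoid 0ℓ 0ℓ
⊕-commutativeMonoid m = record
  { Carrier = Vec Bool m ; _≈_ = _≡_ ; _∙_ = _⊕_ ; ε = 𝟘 m
  ; isCommutativeMonoid = record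
    { isMonoid = record
      { isSemigroup = record
        { isMagma = record { isEquivalence = isEquivalence ; ∙-cong = cong₂ _⊕_ }
        ; assoc = ⊕-assoc }
      ; identity = ⊕-identityˡ , ⊕-identityʳ }
    ; comm = ⊕-comm } }

module ⊕-Properties {m : ℕ} = CommSemigroupProperties (CommutativeMonoid.commutativeSemigroup (⊕-commutativeMonoid m))

⊕-swap : ∀ {m} (u v w : Vec Bool m) → u ⊕ (v ⊕ w) ≡ v ⊕ (u ⊕ w)
⊕-swap = ⊕-Properties.x∙yz≈y∙xz

⊕-interchange : ∀ {m} (a b c d : Vec Bool m) → (a ⊕ b) ⊕ (c ⊕ d) ≡ (a ⊕ c) ⊕ (b ⊕ d)
⊕-interchange = ⊕-Properties.interchange

⊕-cancel : ∀ {m} (u v : Vec Bool m) → u ⊕ v ≡ 𝟘 m → u ≡ v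
⊕-cancel {m} u v u⊕v≡0 = begin
  u             ≡⟨ sym (⊕-identityʳ u) ⟩
  u ⊕ 𝟘 m       ≡⟨ cong (u ⊕_) (sym (⊕-self v)) ⟩
  u ⊕ (v ⊕ v)   ≡⟨ sym (⊕-assoc u v v) ⟩
  (u ⊕ v) ⊕ v   ≡⟨ cong (_⊕ v) u⊕v≡0 ⟩
  𝟘 m ⊕ v       ≡⟨ ⊕-identityˡ v ⟩
  v             ∎
  where open ≡-Reasoning

·-distrib-xor : ∀ {m} a b (v : Vec Bool m) → (a xor b) · v ≡ a · v ⊕ b · v
·-distrib-xor true true v = sym (⊕-self v)
·-distrib-xor true false v = sym (⊕-identityʳ v)
·-distrib-xor false true v = sym (⊕-identityˡ v)
·-distrib-xor false false v = sym (⊕-identityˡ _)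

infixl 6 _Δ_
_Δ_ : ∀ {n} → Subset n → Subset n → Subset n
_Δ_ = zipWith _xor_

colSum-⊥ : ∀ {m n} (A : Matrix₂ m n) → colSum A ⊥ ≡ 𝟘 m
colSum-⊥ {n = zero} A = refl
colSum-⊥ {n = suc n} A = trans (⊕-identityˡ _) (colSum-⊥ (λ i → A (suc i)))

colSum-⁅⁆ : ∀ {m n} (A : Matrix₂ m n) e → colSum A ⁅ e ⁆ ≡ A e
colSum-⁅⁆ A zero = trans (cong (A zero ⊕_) (colSum-⊥ (λ i → A (suc i)))) (⊕-identityʳ _)
colSum-⁅⁆ A (suc e) = trans (⊕-identityˡ _) (colSum-⁅⁆ (λ i → A (suc i)) e)

colSum-Δ : ∀ {m n} (A : Matrix₂ m n) X Y → colSum A (X Δ Y) ≡ colSum A X ⊕ colSum A Y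
colSum-Δ A [] [] = sym (⊕-identityˡ _)
colSum-Δ A (b ∷ X) (c ∷ Y) =
  trans (cong₂ _⊕_ (·-distrib-xor b c (A zero)) (colSum-Δ (λ i → A (suc i)) X Y))
        (⊕-interchange (b · A zero) (c · A zero) _ _)

colSum-insertAt : ∀ {m n} (A : Matrix₂ m (suc n)) Y e b →
  colSum A (insertAt Y e b) ≡ b · A e ⊕ colSum (λ j → A (punchIn e j)) Y
colSum-insertAt A Y zero b = refl
colSum-insertAt A (y ∷ Y) (suc e) b =
  trans (cong (y · A zero ⊕_) (colSum-insertAt (λ i → A (suc i)) Y e b))
        (⊕-swap (y · A zero) (b · A (suc e)) _)

colSum-linear : ∀ {m n} (f : Vec Bool m → Vec Bool m) → f (𝟘 m) ≡ 𝟘 m →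
  (∀ u v → f (u ⊕ v) ≡ f u ⊕ f v) → (A : Matrix₂ m n) → ∀ Y →
  colSum (λ j → f (A j)) Y ≡ f (colSum A Y)
colSum-linear f f0 f⊕ A [] = sym f0
colSum-linear f f0 f⊕ A (b ∷ Y) =
  trans (cong₂ _⊕_ (f· b) (colSum-linear f f0 f⊕ (λ i → A (suc i)) Y)) (sym (f⊕ _ _))
  where
  f· : ∀ b → b · f (A zero) ≡ f (b · A zero)
  f· true = refl
  f· false = sym f0

infix 7 _⊆ᵇ_
_⊆ᵇ_ : ∀ {n} → Subset n → Subset n → Bool
[] ⊆ᵇ [] = true
(b ∷ Y) ⊆ᵇ (c ∷ X) = (b ⇒ᵇ c) ∧ (Y ⊆ᵇ X)

nonemptyᵇ : ∀ {n} → Subset n → Bool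
nonemptyᵇ [] = false
nonemptyᵇ (b ∷ Y) = b ∨ nonemptyᵇ Y

⊆ᵇ-sound : ∀ {n} (Y X : Subset n) → Y ⊆ᵇ X ≡ true → Y ⊆ X
⊆ᵇ-sound (true ∷ Y) (true ∷ X) _ here = here
⊆ᵇ-sound (b ∷ Y) (c ∷ X) Y⊆X (there i∈Y) = there (⊆ᵇ-sound Y X (proj₂ (∧-split (b ⇒ᵇ c) _ Y⊆X)) i∈Y)

∈-tail : ∀ {n b i} {X : Subset n} → (b ∷ X) [ suc i ]= true → X [ i ]= true
∈-tail (there i∈X) = i∈X

⊆ᵇ-complete : ∀ {n} (Y X : Subset n) → Y ⊆ X → Y ⊆ᵇ X ≡ true
⊆ᵇ-complete [] [] _ = refl
⊆ᵇ-complete (true ∷ Y) (c ∷ X) Y⊆X with Y⊆X here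
... | here = ⊆ᵇ-complete Y X (λ i∈Y → ∈-tail (Y⊆X (there i∈Y)))
⊆ᵇ-complete (false ∷ Y) (c ∷ X) Y⊆X = ⊆ᵇ-complete Y X (λ i∈Y → ∈-tail (Y⊆X (there i∈Y)))

⊆ᵇ-refl : ∀ {n} (Y : Subset n) → Y ⊆ᵇ Y ≡ true
⊆ᵇ-refl [] = refl
⊆ᵇ-refl (true ∷ Y) = ⊆ᵇ-refl Y
⊆ᵇ-refl (false ∷ Y) = ⊆ᵇ-refl Y

⊆ᵇ-insertAt : ∀ {n} (Y X : Subset n) e b c → insertAt Y e b ⊆ᵇ insertAt X e c ≡ (b ⇒ᵇ c) ∧ (Y ⊆ᵇ X)
⊆ᵇ-insertAt Y X zero b c = refl
⊆ᵇ-insertAt (y ∷ Y) (x ∷ X) (suc e) b c =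
  trans (cong ((y ⇒ᵇ x) ∧_) (⊆ᵇ-insertAt Y X e b c)) (∧-Properties.x∙yz≈y∙xz (y ⇒ᵇ x) (b ⇒ᵇ c) _)

nonemptyᵇ-sound : ∀ {n} (Y : Subset n) → nonemptyᵇ Y ≡ true → Nonempty Y
nonemptyᵇ-sound (true ∷ Y) _ = zero , here
nonemptyᵇ-sound (false ∷ Y) Y≢∅ with nonemptyᵇ-sound Y Y≢∅
... | i , i∈Y = suc i , there i∈Y

nonemptyᵇ-complete : ∀ {n} (Y : Subset n) → Nonempty Y → nonemptyᵇ Y ≡ true
nonemptyᵇ-complete (true ∷ Y) _ = refl
nonemptyᵇ-complete (false ∷ Y) (suc i , there i∈Y) = nonemptyᵇ-complete Y (i , i∈Y)

nonemptyᵇ-false : ∀ {n} (Y : Subset n) → nonemptyᵇ Y ≡ false → Y ≡ ⊥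
nonemptyᵇ-false [] _ = refl
nonemptyᵇ-false (true ∷ Y) ()
nonemptyᵇ-false (false ∷ Y) Y≡∅ = cong (false ∷_) (nonemptyᵇ-false Y Y≡∅)

nonemptyᵇ-⁅⁆ : ∀ {n} (e : Fin n) → nonemptyᵇ ⁅ e ⁆ ≡ true
nonemptyᵇ-⁅⁆ zero = refl
nonemptyᵇ-⁅⁆ (suc e) = nonemptyᵇ-⁅⁆ e

nonemptyᵇ-insertAt : ∀ {n} (Y : Subset n) e b → nonemptyᵇ (insertAt Y e b) ≡ b ∨ nonemptyᵇ Y
nonemptyᵇ-insertAt Y zero b = refl
nonemptyᵇ-insertAt (y ∷ Y) (suc e) b =
  trans (cong (y ∨_) (nonemptyᵇ-insertAt Y e b)) (∨-Properties.x∙yz≈y∙xz y b _)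

insertAt-elim : ∀ {n} (P : Subset (suc n) → Set) (e : Fin (suc n)) → (∀ Y b → P (insertAt Y e b)) → ∀ Z → P Z
insertAt-elim P e h Z = subst P (insertAt-removeAt Z e) (h (removeAt Z e) (lookup Z e))

-- Binary representations

-- Linear independence of columns, stated with boolean inclusion; it is
-- equivalent to LinIndep₂ and is the form we compute and rewrite with.
Independent₂ : ∀ {m n} → Matrix₂ m n → Subset n → Set
Independent₂ {m} A X = ∀ Y → Y ⊆ᵇ X ≡ true → nonemptyᵇ Y ≡ true → colSum A Y ≢ 𝟘 m

LinIndep₂⇔Independent₂ : ∀ {m n} (A : Matrix₂ m n) X → LinIndep₂ A X ⇔ Independent₂ A X
LinIndep₂⇔Independent₂ A X = mk⇔ reflect unreflect
  where
  reflect : LinIndep₂ A X → Independent₂ A X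
  reflect h Y Y⊆X Y≢∅ = h Y (⊆ᵇ-sound Y X Y⊆X) (nonemptyᵇ-sound Y Y≢∅)
  unreflect : Independent₂ A X → LinIndep₂ A X
  unreflect h Y Y⊆X Y≢∅ = h Y (⊆ᵇ-complete Y X Y⊆X) (nonemptyᵇ-complete Y Y≢∅)

Represents : ∀ {m n} → Matrix₂ m n → Raw n → Set
Represents A M = ∀ X → M X ≡ true ⇔ Independent₂ A X

BinaryRep : ∀ {n} → Raw n → Set
BinaryRep {n} M = Σ ℕ λ m → Σ (Matrix₂ m n) λ A → Represents A M

BinaryRep→Binary : ∀ {n} {M : Raw n} → BinaryRep M → Binary M
BinaryRep→Binary (m , A , rep) = m , A , λ X →
  (λ MX → from (LinIndep₂⇔Independent₂ A X) (to (rep X) MX)) ,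
  (λ li → from (rep X) (to (LinIndep₂⇔Independent₂ A X) li))

Binary→BinaryRep : ∀ {n} {M : Raw n} → Binary M → BinaryRep M
Binary→BinaryRep (m , A , rep) = m , A , λ X → mk⇔
  (λ MX → to (LinIndep₂⇔Independent₂ A X) (proj₁ (rep X) MX))
  (λ li → proj₂ (rep X) (from (LinIndep₂⇔Independent₂ A X) li))

module Deletion {m n} (A : Matrix₂ m (suc n)) (e : Fin (suc n)) where
  A∖e : Matrix₂ m n
  A∖e j = A (punchIn e j)

  colSum-avoiding : ∀ Y → colSum A (insertAt Y e false) ≡ colSum A∖e Y
  colSum-avoiding Y = trans (colSum-insertAt A Y e false) (⊕-identityˡ _)

  independent-deletion : ∀ X → Independent₂ A (insertAt X e false) ⇔ Independent₂ A∖e X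
  independent-deletion X = mk⇔ restrict extend
    where
    restrict : Independent₂ A (insertAt X e false) → Independent₂ A∖e X
    restrict h Y Y⊆X Y≢∅ ΣY≡0 = h (insertAt Y e false) (trans (⊆ᵇ-insertAt Y X e false false) Y⊆X)
      (trans (nonemptyᵇ-insertAt Y e false) Y≢∅) (trans (colSum-avoiding Y) ΣY≡0)

    extend : Independent₂ A∖e X → Independent₂ A (insertAt X e false)
    extend h = insertAt-elim (λ Z → Z ⊆ᵇ insertAt X e false ≡ true → nonemptyᵇ Z ≡ true → colSum A Z ≢ 𝟘 m) e cases
      where
      cases : ∀ Y b → insertAt Y e b ⊆ᵇ insertAt X e false ≡ true → nonemptyᵇ (insertAt Y e b) ≡ true → colSum A (insertAt Y e b) ≢ 𝟘 m
      cases Y true Y⊆X _ _ with trans (sym (⊆ᵇ-insertAt Y X e true false)) Y⊆X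
      ... | ()
      cases Y false Y⊆X Y≢∅ ΣY≡0 = h Y (trans (sym (⊆ᵇ-insertAt Y X e false false)) Y⊆X)
        (trans (sym (nonemptyᵇ-insertAt Y e false)) Y≢∅) (trans (sym (colSum-avoiding Y)) ΣY≡0)

nonzero-entry : ∀ {m} (v : Vec Bool m) → v ≢ 𝟘 m → ∃ λ r → lookup v r ≡ true
nonzero-entry [] v≢0 = ⊥-elim (v≢0 refl)
nonzero-entry (true ∷ v) _ = zero , refl
nonzero-entry (false ∷ v) v≢0 with nonzero-entry v (λ v≡0 → v≢0 (cong (false ∷_) v≡0))
... | r , vr = suc r , vr

-- Contraction of a non-loop e: pivot on a row r where the column of e is 1.
-- The map  v ↦ v + v[r]·A e  is linear and vanishes exactly on 0 and A e,
-- so it identifies the column space of A modulo A e; delete the column of e.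
module Contraction {m n} (A : Matrix₂ m (suc n)) (e : Fin (suc n)) (Ae≢0 : A e ≢ 𝟘 m) where
  open Deletion A e using (A∖e; colSum-avoiding)

  r : Fin m
  r = proj₁ (nonzero-entry (A e) Ae≢0)

  pivot : Vec Bool m → Vec Bool m
  pivot v = v ⊕ lookup v r · A e

  pivot-𝟘 : pivot (𝟘 m) ≡ 𝟘 m
  pivot-𝟘 = trans (cong (λ b → 𝟘 m ⊕ b · A e) (lookup-replicate r false)) (⊕-identityˡ _)

  pivot-⊕ : ∀ u v → pivot (u ⊕ v) ≡ pivot u ⊕ pivot v
  pivot-⊕ u v = trans (cong (λ b → (u ⊕ v) ⊕ b · A e) (lookup-zipWith _xor_ r u v))
    (trans (cong ((u ⊕ v) ⊕_) (·-distrib-xor (lookup u r) (lookup v r) (A e))) (⊕-interchange u v _ _))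

  pivot-Ae : pivot (A e) ≡ 𝟘 m
  pivot-Ae = trans (cong (λ b → A e ⊕ b · A e) (proj₂ (nonzero-entry (A e) Ae≢0))) (⊕-self (A e))

  pivot-kernel : ∀ w → pivot w ≡ 𝟘 m → (w ≡ 𝟘 m) ⊎ (A e ⊕ w ≡ 𝟘 m)
  pivot-kernel w pw≡0 with lookup w r
  ... | false = inj₁ (trans (sym (⊕-identityʳ w)) pw≡0)
  ... | true = inj₂ (trans (⊕-comm (A e) w) pw≡0)

  A／e : Matrix₂ m n
  A／e j = pivot (A∖e j)

  colSum-A／e : ∀ Y → colSum A／e Y ≡ pivot (colSum A∖e Y)
  colSum-A／e = colSum-linear pivot pivot-𝟘 pivot-⊕ A∖e

  column-of-e : ∀ Y → colSum A (insertAt Y e true) ≡ 𝟘 m → A e ≡ colSum A∖e Y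
  column-of-e Y ΣY≡0 = ⊕-cancel (A e) (colSum A∖e Y) (trans (sym (colSum-insertAt A Y e true)) ΣY≡0)

  independent-contraction : ∀ X → Independent₂ A (insertAt X e true) ⇔ Independent₂ A／e X
  independent-contraction X = mk⇔ restrict extend
    where
    restrict : Independent₂ A (insertAt X e true) → Independent₂ A／e X
    restrict h Y Y⊆X Y≢∅ ΣY≡0 with pivot-kernel (colSum A∖e Y) (trans (sym (colSum-A／e Y)) ΣY≡0)
    ... | inj₁ w≡0 = h (insertAt Y e false) (trans (⊆ᵇ-insertAt Y X e false true) Y⊆X)
      (trans (nonemptyᵇ-insertAt Y e false) Y≢∅) (trans (colSum-avoiding Y) w≡0)
    ... | inj₂ Ae+w≡0 = h (insertAt Y e true) (trans (⊆ᵇ-insertAt Y X e true true) Y⊆X)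
      (nonemptyᵇ-insertAt Y e true) (trans (colSum-insertAt A Y e true) Ae+w≡0)

    extend : Independent₂ A／e X → Independent₂ A (insertAt X e true)
    extend h = insertAt-elim (λ Z → Z ⊆ᵇ insertAt X e true ≡ true → nonemptyᵇ Z ≡ true → colSum A Z ≢ 𝟘 m) e cases
      where
      cases : ∀ Y b → insertAt Y e b ⊆ᵇ insertAt X e true ≡ true → nonemptyᵇ (insertAt Y e b) ≡ true → colSum A (insertAt Y e b) ≢ 𝟘 m
      cases Y false Y⊆X Y≢∅ ΣY≡0 = h Y (trans (sym (⊆ᵇ-insertAt Y X e false true)) Y⊆X)
        (trans (sym (nonemptyᵇ-insertAt Y e false)) Y≢∅)
        (trans (colSum-A／e Y) (trans (cong pivot (trans (sym (colSum-avoiding Y)) ΣY≡0)) pivot-𝟘))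
      cases Y true Y⊆X _ ΣY≡0 with nonemptyᵇ Y in Y≢∅
      ... | true = h Y (trans (sym (⊆ᵇ-insertAt Y X e true true)) Y⊆X) Y≢∅
        (trans (colSum-A／e Y) (trans (cong pivot (sym (column-of-e Y ΣY≡0))) pivot-Ae))
      ... | false = Ae≢0 (trans (column-of-e Y ΣY≡0) (trans (cong (colSum A∖e) (nonemptyᵇ-false Y Y≢∅)) (colSum-⊥ A∖e)))

BinaryRep-deletion : ∀ {n} {M : Raw (suc n)} e → BinaryRep M → BinaryRep (M ∖ e)
BinaryRep-deletion e (m , A , rep) = m , A∖e , λ X → mk⇔
  (λ MX → to (independent-deletion X) (to (rep (insertAt X e false)) MX))
  (λ li → from (rep (insertAt X e false)) (from (independent-deletion X) li))
  where open Deletion A e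

BinaryRep-contraction-nonloop : ∀ {n} {M : Raw (suc n)} e → M ⁅ e ⁆ ≡ true → BinaryRep M →
  BinaryRep (λ X → M (insertAt X e true))
BinaryRep-contraction-nonloop e e-indep (m , A , rep) = m , A／e , λ X → mk⇔
  (λ MX → to (independent-contraction X) (to (rep (insertAt X e true)) MX))
  (λ li → from (rep (insertAt X e true)) (from (independent-contraction X) li))
  where
  Ae≢0 : A e ≢ 𝟘 m
  Ae≢0 Ae≡0 = to (rep ⁅ e ⁆) e-indep ⁅ e ⁆ (⊆ᵇ-refl ⁅ e ⁆) (nonemptyᵇ-⁅⁆ e) (trans (colSum-⁅⁆ A e) Ae≡0)
  open Contraction A e Ae≢0

BinaryRep-contraction : ∀ {n} {M : Raw (suc n)} e → BinaryRep M → BinaryRep (M ／ e)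
BinaryRep-contraction {M = M} e bin with M ⁅ e ⁆ in e-indep
... | false = BinaryRep-deletion e bin
... | true = BinaryRep-contraction-nonloop e e-indep bin

BinaryRep-minor : ∀ {k n} {N : Raw k} {M : Raw n} → BinaryRep M → N ≼ M → BinaryRep N
BinaryRep-properMinor : ∀ {k n} {N : Raw k} {M : Raw n} → BinaryRep M → N ≺ M → BinaryRep N
BinaryRep-minor bin self = bin
BinaryRep-minor bin (proper N≺M) = BinaryRep-properMinor bin N≺M
BinaryRep-properMinor bin (via-del e N≼M∖e) = BinaryRep-minor (BinaryRep-deletion e bin) N≼M∖e
BinaryRep-properMinor bin (via-con e N≼M／e) = BinaryRep-minor (BinaryRep-contraction e bin) N≼M／e

BinaryRep⇒InZ : ∀ {n} {M : Raw n} → BinaryRep M → InZ M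
BinaryRep⇒InZ {zero} _ = tt
BinaryRep⇒InZ {suc n} bin e = inj₁ (BinaryRep→Binary (BinaryRep-deletion e bin))

-- Finite checkers

allSubsets : ∀ {n} → (Subset n → Bool) → Bool
allSubsets {zero} p = p []
allSubsets {suc n} p = allSubsets (λ Y → p (true ∷ Y)) ∧ allSubsets (λ Y → p (false ∷ Y))

allSubsets-sound : ∀ {n} (p : Subset n → Bool) → allSubsets p ≡ true → ∀ Y → p Y ≡ true
allSubsets-sound {zero} p h [] = h
allSubsets-sound {suc n} p h (true ∷ Y) = allSubsets-sound _ (proj₁ (∧-split _ _ h)) Y
allSubsets-sound {suc n} p h (false ∷ Y) = allSubsets-sound _ (proj₂ (∧-split _ _ h)) Y

allSubsets-complete : ∀ {n} (p : Subset n → Bool) → (∀ Y → p Y ≡ true) → allSubsets p ≡ true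
allSubsets-complete {zero} p h = h []
allSubsets-complete {suc n} p h =
  ∧-intro (allSubsets-complete _ (λ Y → h (true ∷ Y))) (allSubsets-complete _ (λ Y → h (false ∷ Y)))

allElements : ∀ {n} → (Fin n → Bool) → Bool
allElements {zero} p = true
allElements {suc n} p = p zero ∧ allElements (λ i → p (suc i))

allElements-sound : ∀ {n} (p : Fin n → Bool) → allElements p ≡ true → ∀ i → p i ≡ true
allElements-sound p h zero = proj₁ (∧-split _ _ h)
allElements-sound p h (suc i) = allElements-sound _ (proj₂ (∧-split _ _ h)) i

anyElement : ∀ {n} → (Fin n → Bool) → Bool
anyElement {zero} p = false
anyElement {suc n} p = p zero ∨ anyElement (λ i → p (suc i))

anyElement-sound : ∀ {n} (p : Fin n → Bool) → anyElement p ≡ true → ∃ λ i → p i ≡ true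
anyElement-sound {suc n} p h with ∨-split (p zero) _ h
... | inj₁ p0 = zero , p0
... | inj₂ rest with anyElement-sound _ rest
... | i , pi = suc i , pi

isZero? : ∀ {m} (v : Vec Bool m) → Dec (v ≡ 𝟘 m)
isZero? {m} v = ≡-dec _≟ᵇ_ v (𝟘 m)

independent? : ∀ {m n} → Matrix₂ m n → Subset n → Bool
independent? A X = allSubsets (λ Y → (Y ⊆ᵇ X ∧ nonemptyᵇ Y) ⇒ᵇ not (does (isZero? (colSum A Y))))

independent?-sound : ∀ {m n} (A : Matrix₂ m n) X → independent? A X ≡ true → Independent₂ A X
independent?-sound A X h Y Y⊆X Y≢∅ ΣY≡0 =
  not-true _ (⇒ᵇ-mp (allSubsets-sound _ h Y) (∧-intro Y⊆X Y≢∅)) (dec-true (isZero? (colSum A Y)) ΣY≡0)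

independent?-complete : ∀ {m n} (A : Matrix₂ m n) X → Independent₂ A X → independent? A X ≡ true
independent?-complete A X h = allSubsets-complete _ check
  where
  check : ∀ Y → (Y ⊆ᵇ X ∧ nonemptyᵇ Y) ⇒ᵇ not (does (isZero? (colSum A Y))) ≡ true
  check Y with Y ⊆ᵇ X in Y⊆X | nonemptyᵇ Y in Y≢∅ | isZero? (colSum A Y)
  ... | false | _ | _ = refl
  ... | true | false | _ = refl
  ... | true | true | no _ = refl
  ... | true | true | yes ΣY≡0 = ⊥-elim (h Y Y⊆X Y≢∅ ΣY≡0)

represents? : ∀ {m n} → Matrix₂ m n → Raw n → Bool
represents? A N = allSubsets (λ X → does (N X ≟ᵇ independent? A X))

represents?-sound : ∀ {m n} (A : Matrix₂ m n) (N : Raw n) → represents? A N ≡ true → Represents A N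
represents?-sound A N h X = mk⇔
  (λ NX → independent?-sound A X (trans (sym agree) NX))
  (λ li → trans agree (independent?-complete A X li))
  where
  agree : N X ≡ independent? A X
  agree = does-true (N X ≟ᵇ independent? A X) (allSubsets-sound _ h X)

-- Candidate representation: grow a basis B greedily and give each element
-- the incidence vector of its fundamental circuit with respect to B.  For a
-- binary matroid this is a GF(2) representation (binary matroids are
-- uniquely representable); here it is only a guess, validated by represents?.
greedyBasis : ∀ {n} → Raw n → Subset n
greedyBasis {n} N = foldl (λ _ → Subset n) (λ B i → if N (B ∪ ⁅ i ⁆) then B ∪ ⁅ i ⁆ else B) ⊥ (allFin n)

fundamentalCircuitMatrix : ∀ {n} → Raw n → Subset n → Matrix₂ n n
fundamentalCircuitMatrix N B e =
  if lookup B e then ⁅ e ⁆ else tabulate (λ r → lookup B r ∧ N ((B ∪ ⁅ e ⁆) [ r ]≔ false))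

binary? : ∀ {n} → Raw n → Bool
binary? N = represents? (fundamentalCircuitMatrix N (greedyBasis N)) N

binary?-sound : ∀ {n} (N : Raw n) → binary? N ≡ true → BinaryRep N
binary?-sound {n} N h = n , _ , represents?-sound _ N h

inZ? : ∀ {n} → Raw n → Bool
inZ? {zero} N = true
inZ? {suc n} N = allElements (λ e → binary? (N ∖ e) ∨ binary? (N ／ e))

inZ?-sound : ∀ {n} (N : Raw n) → inZ? N ≡ true → InZ N
inZ?-sound {zero} N h = tt
inZ?-sound {suc n} N h e with ∨-split (binary? (N ∖ e)) _ (allElements-sound (λ e → binary? (N ∖ e) ∨ binary? (N ／ e)) h e)
... | inj₁ del = inj₁ (BinaryRep→Binary (binary?-sound _ del))
... | inj₂ con = inj₂ (BinaryRep→Binary (binary?-sound _ con))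

minorsInZ? : ∀ {n} → Raw n → Bool
properMinorsInZ? : ∀ {n} → Raw (suc n) → Bool
minorsInZ? {zero} N = true
minorsInZ? {suc n} N = binary? N ∨ (inZ? N ∧ properMinorsInZ? N)
properMinorsInZ? N = allElements (λ e → minorsInZ? (N ∖ e) ∧ minorsInZ? (N ／ e))

properMinorsInZ?-at : ∀ {n} (M : Raw (suc n)) → properMinorsInZ? M ≡ true →
  ∀ e → minorsInZ? (M ∖ e) ≡ true × minorsInZ? (M ／ e) ≡ true
properMinorsInZ?-at M h e = ∧-split _ _ (allElements-sound (λ e → minorsInZ? (M ∖ e) ∧ minorsInZ? (M ／ e)) h e)

minorsInZ?-sound : ∀ {n} (M : Raw n) → minorsInZ? M ≡ true → ∀ {k} (N : Raw k) → N ≼ M → InZ N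
properMinorsInZ?-sound : ∀ {n} (M : Raw (suc n)) → properMinorsInZ? M ≡ true → ∀ {k} (N : Raw k) → N ≺ M → InZ N
minorsInZ?-sound {zero} M h N self = tt
minorsInZ?-sound {suc n} M h N N≼M with ∨-split (binary? M) _ h
... | inj₁ bin = BinaryRep⇒InZ (BinaryRep-minor (binary?-sound M bin) N≼M)
... | inj₂ rest with ∧-split (inZ? M) _ rest | N≼M
... | M∈Z , _ | self = inZ?-sound M M∈Z
... | _ , proper-ok | proper N≺M = properMinorsInZ?-sound M proper-ok N N≺M
properMinorsInZ?-sound M h N (via-del e N≼M∖e) =
  minorsInZ?-sound (M ∖ e) (proj₁ (properMinorsInZ?-at M h e)) N N≼M∖e
properMinorsInZ?-sound M h N (via-con e N≼M／e) =
  minorsInZ?-sound (M ／ e) (proj₂ (properMinorsInZ?-at M h e)) N N≼M／e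

downClosed? : ∀ {n} → Raw n → Bool
downClosed? M = allSubsets λ X → allSubsets λ Y → (X ⊆ᵇ Y ∧ M Y) ⇒ᵇ M X

augmentation? : ∀ {n} → Raw n → Bool
augmentation? M = allSubsets λ X → allSubsets λ Y → (M X ∧ M Y ∧ (∣ X ∣ <ᵇ ∣ Y ∣)) ⇒ᵇ
  anyElement (λ e → lookup Y e ∧ not (lookup X e) ∧ M (X ∪ ⁅ e ⁆))

matroid? : ∀ {n} → Raw n → Bool
matroid? M = M ⊥ ∧ downClosed? M ∧ augmentation? M

matroid?-sound : ∀ {n} (M : Raw n) → matroid? M ≡ true → IsMatroid M
matroid?-sound M h = record { empty-indep = M∅ ; down-closed = down-closed ; augment = augment }
  where
  M∅ : M ⊥ ≡ true
  M∅ = proj₁ (∧-split (M ⊥) _ h)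
  axioms : downClosed? M ≡ true × augmentation? M ≡ true
  axioms = ∧-split (downClosed? M) _ (proj₂ (∧-split (M ⊥) _ h))

  down-closed : ∀ X Y → X ⊆ Y → M Y ≡ true → M X ≡ true
  down-closed X Y X⊆Y MY =
    ⇒ᵇ-mp (allSubsets-sound _ (allSubsets-sound _ (proj₁ axioms) X) Y) (∧-intro (⊆ᵇ-complete X Y X⊆Y) MY)

  augment : ∀ X Y → M X ≡ true → M Y ≡ true → ∣ X ∣ < ∣ Y ∣ → ∃ λ e → e ∈ Y × e ∉ X × M (X ∪ ⁅ e ⁆) ≡ true
  augment X Y MX MY X<Y
    with anyElement-sound _ (⇒ᵇ-mp (allSubsets-sound _ (allSubsets-sound _ (proj₂ axioms) X) Y)
                                   (∧-intro MX (∧-intro MY (to T-≡ (<⇒<ᵇ X<Y)))))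
  ... | e , found with ∧-split (lookup Y e) _ found
  ... | e∈Y , found′ with ∧-split (not (lookup X e)) _ found′
  ... | e∉X , MXe = e , lookup⇒[]= e Y e∈Y , (λ e∈X → not-true _ e∉X ([]=⇒lookup e∈X)) , MXe

-- A certificate of non-binarity

circuit? : ∀ {n} → Raw n → Subset n → Bool
circuit? N C = not (N C) ∧ allSubsets (λ T → T ⊆ᵇ C ⇒ᵇ (does (≡-dec _≟ᵇ_ T C) ∨ N T))

-- In a GF(2) representation the columns of a circuit sum to zero: otherwise
-- the circuit itself would be an independent column set.
circuit-colSum : ∀ {m n} {N : Raw n} (A : Matrix₂ m n) → Represents A N →
  ∀ C → circuit? N C ≡ true → colSum A C ≡ 𝟘 m
circuit-colSum {N = N} A rep C h with isZero? (colSum A C)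
... | yes ΣC≡0 = ΣC≡0
... | no ΣC≢0 = ⊥-elim (not-true _ dependent (from (rep C) C-independent))
  where
  dependent : not (N C) ≡ true
  dependent = proj₁ (∧-split (not (N C)) _ h)

  minimal : ∀ T → T ⊆ᵇ C ≡ true → does (≡-dec _≟ᵇ_ T C) ∨ N T ≡ true
  minimal T T⊆C = ⇒ᵇ-mp (allSubsets-sound (λ T → T ⊆ᵇ C ⇒ᵇ (does (≡-dec _≟ᵇ_ T C) ∨ N T))
                          (proj₂ (∧-split (not (N C)) _ h)) T) T⊆C

  C-independent : Independent₂ A C
  C-independent Y Y⊆C Y≢∅ with ≡-dec _≟ᵇ_ Y C | minimal Y Y⊆C
  ... | yes refl | _ = ΣC≢0
  ... | no _ | NY = to (rep Y) NY Y (⊆ᵇ-refl Y) Y≢∅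

nonBinaryWitness? : ∀ {n} → Raw n → Subset n → Subset n → Bool
nonBinaryWitness? N C₁ C₂ = circuit? N C₁ ∧ circuit? N C₂ ∧ N (C₁ Δ C₂) ∧ nonemptyᵇ (C₁ Δ C₂)

-- Such a witness rules out a GF(2) representation: the columns of C₁ Δ C₂
-- would sum to the sum of two zero vectors.
nonBinaryWitness?-sound : ∀ {n} (N : Raw n) C₁ C₂ → nonBinaryWitness? N C₁ C₂ ≡ true → ¬ Binary N
nonBinaryWitness?-sound N C₁ C₂ h bin with ∧-split (circuit? N C₁) _ h
... | C₁-circuit , h₁ with ∧-split (circuit? N C₂) _ h₁
... | C₂-circuit , h₂ with ∧-split (N (C₁ Δ C₂)) _ h₂ | Binary→BinaryRep bin
... | Δ-indep , Δ≢∅ | m , A , rep = to (rep (C₁ Δ C₂)) Δ-indep (C₁ Δ C₂) (⊆ᵇ-refl (C₁ Δ C₂)) Δ≢∅ ΣΔ≡0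
  where
  ΣΔ≡0 : colSum A (C₁ Δ C₂) ≡ 𝟘 m
  ΣΔ≡0 = begin
    colSum A (C₁ Δ C₂)          ≡⟨ colSum-Δ A C₁ C₂ ⟩
    colSum A C₁ ⊕ colSum A C₂   ≡⟨ cong₂ _⊕_ (circuit-colSum A rep C₁ C₁-circuit) (circuit-colSum A rep C₂ C₂-circuit) ⟩
    𝟘 m ⊕ 𝟘 m                   ≡⟨ ⊕-identityˡ (𝟘 m) ⟩
    𝟘 m                         ∎
    where open ≡-Reasoning

notInZ : ∀ {n} (M : Raw (suc n)) e C₁ C₂ D₁ D₂ →
  nonBinaryWitness? (M ∖ e) C₁ C₂ ≡ true → nonBinaryWitness? (M ／ e) D₁ D₂ ≡ true → ¬ InZ M
notInZ M e C₁ C₂ D₁ D₂ del con M∈Z with M∈Z e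
... | inj₁ M∖e-binary = nonBinaryWitness?-sound (M ∖ e) C₁ C₂ del M∖e-binary
... | inj₂ M／e-binary = nonBinaryWitness?-sound (M ／ e) D₁ D₂ con M／e-binary

lemma2p10 : ExcludedMinorZ Q6 × ExcludedMinorZ P6 × ExcludedMinorZ U36
lemma2p10 =
  excludedMinor Q6 refl refl refl refl ,
  excludedMinor P6 refl refl refl refl ,
  excludedMinor U36 refl refl refl refl
  where
  -- In the labels of M: in M \ 0 the sets {1,2,3,5} and {1,2,4,5}, and in
  -- M / 0 the sets {1,3,5} and {1,4,5}, are circuits whose symmetric
  -- difference {3,4} is independent.  (Deleting or contracting 0 shifts
  -- labels down by one.)
  C₁ C₂ D₁ D₂ : Subset 5
  C₁ = true ∷ true ∷ true ∷ false ∷ true ∷ []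
  C₂ = true ∷ true ∷ false ∷ true ∷ true ∷ []
  D₁ = true ∷ false ∷ true ∷ false ∷ true ∷ []
  D₂ = true ∷ false ∷ false ∷ true ∷ true ∷ []

  excludedMinor : (M : Raw 6) → matroid? M ≡ true →
    nonBinaryWitness? (M ∖ zero) C₁ C₂ ≡ true → nonBinaryWitness? (M ／ zero) D₁ D₂ ≡ true →
    properMinorsInZ? M ≡ true → ExcludedMinorZ M
  excludedMinor M matroid del con minors =
    matroid?-sound M matroid , notInZ M zero C₁ C₂ D₁ D₂ del con , properMinorsInZ?-sound M minors
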